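{- Let $k\ge 2$, $n=2^k$, and consider the RBO receiver with data as in the context. Suppose $t'=s$. Then for every $i\in[[0,\mathrm{last}]]$ and every $j\in[[0,l_i]]$, $$\bigcup_{t\in Y_{i,j}}L_t\subseteq\{p'_{i,j}\}\cap X_{i,j}.$$
   Context: $[[a,b]]=\{x\in\mathbb Z: a\le x\le b\}$. For an integer $x$, $\mathrm{bin}_k(x)$ is the length-$k$ binary string (most significant bit first) representing $x\bmod 2^k$; for a binary string $\alpha$, $(\alpha)_2$ is the number it represents (empty string represents $0$), $(0)^d$ is the string of $d$ zeros, juxtaposition is concatenation. $\mathrm{rev}_k(x)$ is the integer whose $k$-bit binary representation is the reversal of $\mathrm{bin}_k(x)$; $\mathrm{rev}_kS=\{\mathrm{rev}_k(x):x\in S\}$. RBO protocol: real keys $\kappa_0\le\dots\le\kappa_{n-1}$, and set $\kappa_{ -1}=-\infty$, $\kappa_n=+\infty$; at every time slot $t=0,1,2,\dots$ the broadcaster transmits $\kappa_{\mathrm{rev}_k(t)}$. A receiver with query reals $-\infty<\kappa'\le\kappa''<+\infty$ starts at time slot $s\in[[0,n-1]]$ with $\mathrm{lb}=0$, $\mathrm{ub}=n-1$, and at each slot $t\ge s$: if $\mathrm{lb}\le\mathrm{rev}_k(t)\le\mathrm{ub}$ it receives $\kappa=\kappa_{\mathrm{rev}_k(t)}$; if $\kappa<\kappa'$ it sets $\mathrm{lb}:=\mathrm{rev}_k(t)+1$; if $\kappa''<\kappa$ it sets $\mathrm{ub}:=\mathrm{rev}_k(t)-1$. Let $\mathrm{lb}_t$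 be the value of $\mathrm{lb}$ just before time slot $t$ (so $\mathrm{lb}_t=0$ for $t\le s$), and for $t\ge s$ let $L_t=\{\mathrm{lb}_{t+1}-1\}\setminus\{\mathrm{lb}_t-1\}$. Let $r'=\min\{r\in[[0,n]]:\kappa'\le\kappa_r\}$. Let $t'=\min\{t\in[[s,s+n-1]]:\mathrm{lb}_{t+1}>0\}$ (the first slot at which $\mathrm{lb}$ is updated). Define $t_0=s$ and for $i\ge0$: $l_i=\max\{l\in[[0,k]]:t_i\equiv0\pmod{2^l}\}$, $t_{i+1}=t_i+2^{l_i}$; $\mathrm{last}=\min\{i\ge0:l_i=k\}$. For $i\in[[0,\mathrm{last}]]$, $\beta_i$ is the binary string of length $k-l_i$ with $\mathrm{rev}_k(t_i)=((0)^{l_i}\beta_i)_2$. For $j\in[[0,l_i]]$: $Y_{i,0}=\{t_i\}$, $Y_{i,j}=[[t_i+2^{j-1},t_i+2^j-1]]$ for $j\ge1$; $X_{i,j}=\mathrm{rev}_kY_{i,j}$; $\mathbb X_{i,j}=\{x\in\mathbb Z: x\bmod 2^{k-j}=((0)^{l_i-j}\beta_i)_2\}$; $p'_{i,j}=\max\{x\in\mathbb X_{i,j}: x<r'\}$.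
   Formalization: The keys $\kappa_0\le\dots\le\kappa_{n-1}$ and the query values $\kappa'$ and $\kappa''$ are rationals rather than reals. -}

module Defs where

open import Data.Nat as ℕ using (ℕ; zero; suc; _+_; _*_; _∸_; _^_; _/_; _%_; _≡ᵇ_)
open import Data.Nat.Properties using (m^n≢0)
open import Data.Nat.Divisibility using (_∣?_)
open import Data.Bool using (Bool; true; false; if_then_else_; _∧_)
open import Data.List using (List; []; _∷_; _++_; replicate; reverse; drop; foldl)
open import Data.Integer as ℤ using (ℤ; +_; _%ℕ_)
import Data.Integer.Properties as ℤP
open import Data.Rational as ℚ using (ℚ)
import Data.Rational.Properties as ℚP
open import Data.Product using (_×_; _,_; proj₁; proj₂; Σ; ∃)
open import Relation.Nullary.Decidable using (does)
open import Relation.Binary.PropositionalEquality using (_≡_; _≢_)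

-- bin k x : length-k binary string (MSB first) of x mod 2^k
bin : ℕ → ℕ → List Bool
bin zero    x = []
bin (suc k) x = bin k (x / 2) ++ ((x % 2 ≡ᵇ 1) ∷ [])

val : List Bool → ℕ
val = foldl (λ acc b → 2 * acc + (if b then 1 else 0)) 0

rev : ℕ → ℕ → ℕ
rev k x = val (reverse (bin k x))

maxPow2 : ℕ → ℕ → ℕ
maxPow2 zero    t = 0
maxPow2 (suc l) t = if does (2 ^ suc l ∣? t) then suc l else maxPow2 l t

IsMax : (ℤ → Set) → ℤ → Set
IsMax P x = P x × (∀ y → P y → y ℤ.≤ x)

-- RBO instance: k, keys κ (κ_0..κ_{n-1} are κ 0 .. κ (n-1)), queries κ' κ'', start slot s
module RBO (k : ℕ) (κ : ℕ → ℚ) (κ' κ'' : ℚ) (s : ℕ) where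

  n : ℕ
  n = 2 ^ k

  State : Set
  State = ℤ × ℤ

  step : ℕ → State → State
  step t (lb , ub) =
    if does (lb ℤP.≤? + r) ∧ does (+ r ℤP.≤? ub)
    then ( (if does (κv ℚP.<? κ') then + r ℤ.+ ℤ.1ℤ else lb)
         , (if does (κ'' ℚP.<? κv) then + r ℤ.- ℤ.1ℤ else ub) )
    else (lb , ub)
    where
      r = rev k t
      κv = κ r

  -- state just before time slot s + m
  run : ℕ → State
  run zero    = (+ 0 , + (n ∸ 1))
  run (suc m) = step (s + m) (run m)

  -- lb_t : value of lb just before slot t  (= 0 for t ≤ s)
  lbAt : ℕ → ℤ
  lbAt t = proj₁ (run (t ∸ s))

  InL : ℕ → ℤ → Set
  InL t x = (x ≡ lbAt (suc t) ℤ.- ℤ.1ℤ) × (x ≢ lbAt t ℤ.- ℤ.1ℤ)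

  -- r' = min { r ∈ [[0,n]] : κ' ≤ κ_r }, with κ_n = +∞
  search : ℕ → ℕ → ℕ
  search i zero    = i
  search i (suc f) = if does (κ' ℚP.≤? κ i) then i else search (suc i) f

  r' : ℕ
  r' = search 0 n

  tseq : ℕ → ℕ
  lseq : ℕ → ℕ
  tseq zero    = s
  tseq (suc i) = tseq i + 2 ^ lseq i
  lseq i = maxPow2 k (tseq i)

  -- β_i : rev_k(t_i) = ((0)^{l_i} β_i)_2, |β_i| = k - l_i
  β : ℕ → List Bool
  β i = drop (lseq i) (bin k (rev k (tseq i)))

  InY : ℕ → ℕ → ℕ → Set
  InY i zero    t = t ≡ tseq i
  InY i (suc j) t = (tseq i + 2 ^ j ℕ.≤ t) × (t ℕ.≤ tseq i + 2 ^ suc j ∸ 1)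

  InX : ℕ → ℕ → ℤ → Set
  InX i j x = Σ ℕ λ y → InY i j y × (x ≡ + rev k y)

  InXX : ℕ → ℕ → ℤ → Set
  InXX i j x = _%ℕ_ x (2 ^ (k ∸ j)) {{m^n≢0 2 (k ∸ j)}}
               ≡ val (replicate (lseq i ∸ j) false ++ β i)

  IsP' : ℕ → ℕ → ℤ → Set
  IsP' i j = IsMax (λ x → InXX i j x × x ℤ.< + r')

{-# OPTIONS --safe #-}
module Submission where

-- When lb changes at slot t it jumps to rev_k t + 1, so L_t = {rev_k t}, and κ_{rev_k t} < κ'
-- gives rev_k t < r'.  Writing t = t_i + m with m < 2^j, the block start t_i is divisible by 2^j,
-- so rev_k t = rev_j m · 2^(k−j) + rev_k t_i: this is the residue condition defining 𝕏_{i,j}.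
-- For maximality: lb never decreases and ub never drops below r' − 1, so every slot u with
-- rev_k u < r' pushes lb above rev_k u; hence no slot u before t has rev_k t < rev_k u < r'.
-- If y = q · 2^(k−j) + rev_k t_i < r' were larger than rev_k t, then q > rev_j m.  For j ≥ 1 the
-- top bit of m is set, so rev_j m is odd, and m₀ = rev_j ⌊q/2⌋ < 2^(j−1) ≤ m reverses to the even
-- number 2⌊q/2⌋ ∈ (rev_j m, q]: the slot t_i + m₀ is such a forbidden earlier slot.

open import Defs
open import Data.Nat using (ℕ; suc; _+_; _∸_; _^_; _≤_; _<_)
open import Data.Integer using (ℤ; +_) renaming (_<_ to _<ℤ_)
open import Data.Rational using (ℚ) renaming (_≤_ to _≤ℚ_)
open import Data.Product using (_×_)
open import Relation.Binary.PropositionalEquality using (_≢_)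

open import Data.Nat
open import Data.Nat.Properties
open import Data.Nat.DivMod
open import Data.Nat.Divisibility using (_∣_; _∣?_; divides; divides-refl; m∣m*n; ∣-trans; 1∣_)
open import Data.Nat.Tactic.RingSolver using (solve-∀)
open import Data.Bool using (Bool; false; if_then_else_)
open import Data.List using (List; []; _∷_; _++_; replicate; reverse; drop; foldl; length)
open import Data.List.Properties using (foldl-++; reverse-++; length-++; length-reverse; ++-assoc; ++-identityʳ)
import Data.Integer as ℤ
import Data.Integer.Properties as ℤ
import Data.Rational as ℚ
import Data.Rational.Properties as ℚ
open import Data.Product using (_,_; ∃-syntax; proj₁; proj₂)
open import Data.Sum using (_⊎_; inj₁; inj₂; [_,_]′)
open import Data.Empty using (⊥; ⊥-elim)
open import Relation.Nullary using (Dec; yes; no; does; ¬_; contradiction)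
open import Relation.Binary.PropositionalEquality

bit : Bool → ℕ
bit b = if b then 1 else 0

bit-parity : ∀ x → bit (x % 2 ≡ᵇ 1) ≡ x % 2
bit-parity x with x % 2 | m%n<n x 2
... | 0 | _ = refl
... | 1 | _ = refl
... | suc (suc _) | s≤s (s≤s ())

foldl-bits : ∀ a bs → foldl (λ acc b → 2 * acc + bit b) a bs ≡ a * 2 ^ length bs + val bs
foldl-bits a [] = sym (trans (+-identityʳ _) (*-identityʳ a))
foldl-bits a (b ∷ bs) = begin
  foldl _ (2 * a + bit b) bs                  ≡⟨ foldl-bits (2 * a + bit b) bs ⟩
  (2 * a + bit b) * 2 ^ length bs + val bs    ≡⟨ shift a (bit b) (2 ^ length bs) (val bs) ⟩
  a * 2 ^ length (b ∷ bs) + (bit b * 2 ^ length bs + val bs)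
                                              ≡⟨ cong (λ v → a * 2 ^ length (b ∷ bs) + v) (foldl-bits (bit b) bs) ⟨
  a * 2 ^ length (b ∷ bs) + val (b ∷ bs)      ∎
  where
  open ≡-Reasoning
  shift : ∀ a b L v → (2 * a + b) * L + v ≡ a * (2 * L) + (b * L + v)
  shift = solve-∀

val-++ : ∀ xs ys → val (xs ++ ys) ≡ val xs * 2 ^ length ys + val ys
val-++ xs ys = trans (foldl-++ _ 0 xs ys) (foldl-bits (val xs) ys)

val-replicate-false : ∀ l → val (replicate l false) ≡ 0
val-replicate-false zero = refl
val-replicate-false (suc l) = val-replicate-false l

length-bin : ∀ k x → length (bin k x) ≡ k
length-bin zero x = refl
length-bin (suc k) x = trans (length-++ (bin k (x / 2))) (trans (+-comm _ 1) (cong suc (length-bin k (x / 2))))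

half-< : ∀ l m → m < 2 ^ suc l → m / 2 < 2 ^ l
half-< l m lt = m<n*o⇒m/o<n (subst (m <_) (*-comm 2 (2 ^ l)) lt)

top-digit-< : ∀ {b y} k → b < 2 → y < 2 ^ k → b * 2 ^ k + y < 2 ^ suc k
top-digit-< {b} {y} k b<2 y< = begin-strict
  b * 2 ^ k + y       <⟨ +-monoʳ-< (b * 2 ^ k) y< ⟩
  b * 2 ^ k + 2 ^ k   ≡⟨ +-comm (b * 2 ^ k) (2 ^ k) ⟩
  suc b * 2 ^ k       ≤⟨ *-monoˡ-≤ (2 ^ k) b<2 ⟩
  2 ^ suc k           ∎
  where open ≤-Reasoning

2^-∣ : ∀ {j l} → j ≤ l → 2 ^ j ∣ 2 ^ l
2^-∣ {j} {l} j≤l = subst (2 ^ j ∣_) (trans (sym (^-distribˡ-+-* 2 j (l ∸ j))) (cong (2 ^_) (m+[n∸m]≡n j≤l))) (m∣m*n (2 ^ (l ∸ j)))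

rev-suc : ∀ k x → rev (suc k) x ≡ x % 2 * 2 ^ k + rev k (x / 2)
rev-suc k x = begin
  val (reverse (bin k (x / 2) ++ (b ∷ [])))   ≡⟨ cong val (reverse-++ (bin k (x / 2)) (b ∷ [])) ⟩
  val ((b ∷ []) ++ reverse (bin k (x / 2)))   ≡⟨ val-++ (b ∷ []) (reverse (bin k (x / 2))) ⟩
  bit b * 2 ^ length (reverse (bin k (x / 2))) + rev k (x / 2)
    ≡⟨ cong₂ (λ d l → d * 2 ^ l + rev k (x / 2)) (bit-parity x)
             (trans (length-reverse (bin k (x / 2))) (length-bin k (x / 2))) ⟩
  x % 2 * 2 ^ k + rev k (x / 2)               ∎
  where
  open ≡-Reasoning
  b = x % 2 ≡ᵇ 1

rev-bit : ∀ k {b} h → b < 2 → rev (suc k) (b + h * 2) ≡ b * 2 ^ k + rev k h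
rev-bit k {b} h b<2 = trans (rev-suc k (b + h * 2)) (cong₂ (λ d q → d * 2 ^ k + rev k q) low high)
  where
  low : (b + h * 2) % 2 ≡ b
  low = trans ([m+kn]%n≡m%n b h 2) (m<n⇒m%n≡m b<2)
  high : (b + h * 2) / 2 ≡ h
  high = trans (+-distrib-/-∣ʳ b (divides-refl h)) (cong₂ _+_ (m<n⇒m/n≡0 b<2) (m*n/n≡m h 2))

rev-zero : ∀ k → rev k 0 ≡ 0
rev-zero zero = refl
rev-zero (suc k) = trans (rev-suc k 0) (rev-zero k)

rev-< : ∀ k x → rev k x < 2 ^ k
rev-< zero x = s≤s z≤n
rev-< (suc k) x = subst (_< 2 ^ suc k) (sym (rev-suc k x)) (top-digit-< k (m%n<n x 2) (rev-< k (x / 2)))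

rev-split : ∀ l d c m → m < 2 ^ l → rev (l + d) (2 ^ l * c + m) ≡ rev l m * 2 ^ d + rev d c
rev-split zero d c zero _ = cong (rev d) (trans (+-identityʳ (1 * c)) (*-identityˡ c))
rev-split zero d c (suc m) (s≤s ())
rev-split (suc l) d c m m< = begin
  rev (suc l + d) (2 ^ suc l * c + m)             ≡⟨ cong (λ z → rev (suc l + d) (2 ^ suc l * c + z)) (m≡m%n+[m/n]*n m 2) ⟩
  rev (suc l + d) (2 ^ suc l * c + (b + h * 2))   ≡⟨ cong (rev (suc l + d)) (lowest-digit (2 ^ l) c b h) ⟩
  rev (suc (l + d)) (b + (2 ^ l * c + h) * 2)     ≡⟨ rev-bit (l + d) _ (m%n<n m 2) ⟩
  b * 2 ^ (l + d) + rev (l + d) (2 ^ l * c + h)   ≡⟨ cong₂ (λ p q → b * p + q) (^-distribˡ-+-* 2 l d) (rev-split l d c h (half-< l m m<)) ⟩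
  b * (2 ^ l * 2 ^ d) + (rev l h * 2 ^ d + rev d c) ≡⟨ regroup b (2 ^ l) (2 ^ d) (rev l h) (rev d c) ⟩
  (b * 2 ^ l + rev l h) * 2 ^ d + rev d c          ≡⟨ cong (λ z → z * 2 ^ d + rev d c) (rev-suc l m) ⟨
  rev (suc l) m * 2 ^ d + rev d c ∎
  where
  open ≡-Reasoning
  b = m % 2
  h = m / 2
  lowest-digit : ∀ P c b h → 2 * P * c + (b + h * 2) ≡ b + (P * c + h) * 2
  lowest-digit = solve-∀
  regroup : ∀ b L D R X → b * (L * D) + (R * D + X) ≡ (b * L + R) * D + X
  regroup = solve-∀

rev-split-≤ : ∀ {j k} c {m} → j ≤ k → m < 2 ^ j → rev k (2 ^ j * c + m) ≡ rev j m * 2 ^ (k ∸ j) + rev (k ∸ j) c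
rev-split-≤ {j} {k} c {m} j≤k m< =
  subst (λ k′ → rev k′ (2 ^ j * c + m) ≡ rev j m * 2 ^ (k ∸ j) + rev (k ∸ j) c)
        (m+[n∸m]≡n j≤k) (rev-split j (k ∸ j) c m m<)

rev-top : ∀ j {b m} → b < 2 → m < 2 ^ j → rev (suc j) (2 ^ j * b + m) ≡ b + rev j m * 2
rev-top j {b} {m} b<2 m< = begin
  rev (suc j) (2 ^ j * b + m)   ≡⟨ cong (λ l → rev l (2 ^ j * b + m)) (+-comm 1 j) ⟩
  rev (j + 1) (2 ^ j * b + m)   ≡⟨ rev-split j 1 b m m< ⟩
  rev j m * 2 + rev 1 b         ≡⟨ cong (λ v → rev j m * 2 + v) (rev-one b<2) ⟩
  rev j m * 2 + b               ≡⟨ +-comm (rev j m * 2) b ⟩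
  b + rev j m * 2               ∎
  where
  open ≡-Reasoning
  rev-one : ∀ {b} → b < 2 → rev 1 b ≡ b
  rev-one {0} _ = refl
  rev-one {1} _ = refl
  rev-one {2+ _} (s≤s (s≤s ()))

rev-involutive : ∀ j {q} → q < 2 ^ j → rev j (rev j q) ≡ q
rev-involutive zero {zero} _ = refl
rev-involutive zero {suc q} (s≤s ())
rev-involutive (suc j) {q} q< = begin
  rev (suc j) (rev (suc j) q)              ≡⟨ cong (rev (suc j)) (trans (cong (rev (suc j)) (m≡m%n+[m/n]*n q 2)) (rev-bit j h b<2)) ⟩
  rev (suc j) (b * 2 ^ j + rev j h)        ≡⟨ cong (λ z → rev (suc j) (z + rev j h)) (*-comm b (2 ^ j)) ⟩
  rev (suc j) (2 ^ j * b + rev j h)        ≡⟨ rev-top j b<2 (rev-< j h) ⟩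
  b + rev j (rev j h) * 2                  ≡⟨ cong (λ z → b + z * 2) (rev-involutive j (half-< j q q<)) ⟩
  b + h * 2                                ≡⟨ m≡m%n+[m/n]*n q 2 ⟨
  q                                        ∎
  where
  open ≡-Reasoning
  b = q % 2
  h = q / 2
  b<2 : b < 2
  b<2 = m%n<n q 2

bin-+-< : ∀ a d {X} → X < 2 ^ d → bin (a + d) X ≡ bin a 0 ++ bin d X
bin-+-< a zero {zero} _ = trans (cong (λ l → bin l 0) (+-identityʳ a)) (sym (++-identityʳ (bin a 0)))
bin-+-< a zero {suc X} (s≤s ())
bin-+-< a (suc d) {X} X< = begin
  bin (a + suc d) X                                  ≡⟨ cong (λ l → bin l X) (+-suc a d) ⟩
  bin (a + d) (X / 2) ++ (X % 2 ≡ᵇ 1) ∷ []           ≡⟨ cong (_++ (X % 2 ≡ᵇ 1) ∷ []) (bin-+-< a d (half-< d X X<)) ⟩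
  (bin a 0 ++ bin d (X / 2)) ++ (X % 2 ≡ᵇ 1) ∷ []    ≡⟨ ++-assoc (bin a 0) (bin d (X / 2)) _ ⟩
  bin a 0 ++ bin (suc d) X                           ∎
  where open ≡-Reasoning

val-bin : ∀ d {X} → X < 2 ^ d → val (bin d X) ≡ X
val-bin zero {zero} _ = refl
val-bin zero {suc X} (s≤s ())
val-bin (suc d) {X} X< = begin
  val (bin d (X / 2) ++ (X % 2 ≡ᵇ 1) ∷ [])     ≡⟨ val-++ (bin d (X / 2)) _ ⟩
  val (bin d (X / 2)) * 2 + bit (X % 2 ≡ᵇ 1)   ≡⟨ cong₂ (λ h b → h * 2 + b) (val-bin d (half-< d X X<)) (bit-parity X) ⟩
  X / 2 * 2 + X % 2                            ≡⟨ +-comm (X / 2 * 2) (X % 2) ⟩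
  X % 2 + X / 2 * 2                            ≡⟨ m≡m%n+[m/n]*n X 2 ⟨
  X                                            ∎
  where open ≡-Reasoning

val-drop-bin : ∀ {l k X} → l ≤ k → X < 2 ^ (k ∸ l) → val (drop l (bin k X)) ≡ X
val-drop-bin {l} {k} {X} l≤k X< = begin
  val (drop l (bin k X))                          ≡⟨ cong (λ k′ → val (drop l (bin k′ X))) (m+[n∸m]≡n l≤k) ⟨
  val (drop l (bin (l + (k ∸ l)) X))              ≡⟨ cong (λ xs → val (drop l xs)) (bin-+-< l (k ∸ l) X<) ⟩
  val (drop l (bin l 0 ++ bin (k ∸ l) X))         ≡⟨ cong (λ n → val (drop n (bin l 0 ++ bin (k ∸ l) X))) (length-bin l 0) ⟨
  val (drop (length (bin l 0)) (bin l 0 ++ bin (k ∸ l) X))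
                                                  ≡⟨ cong val (drop-length-++ (bin l 0) (bin (k ∸ l) X)) ⟩
  val (bin (k ∸ l) X)                             ≡⟨ val-bin (k ∸ l) X< ⟩
  X                                               ∎
  where
  open ≡-Reasoning
  drop-length-++ : ∀ {A : Set} (xs ys : List A) → drop (length xs) (xs ++ ys) ≡ ys
  drop-length-++ [] ys = refl
  drop-length-++ (x ∷ xs) ys = drop-length-++ xs ys

rev-aligned : ∀ {j k} c → j ≤ k → rev k (2 ^ j * c) ≡ rev (k ∸ j) c
rev-aligned {j} {k} c j≤k = begin
  rev k (2 ^ j * c)                       ≡⟨ cong (rev k) (+-identityʳ (2 ^ j * c)) ⟨
  rev k (2 ^ j * c + 0)                   ≡⟨ rev-split-≤ c j≤k (m^n>0 2 j) ⟩
  rev j 0 * 2 ^ (k ∸ j) + rev (k ∸ j) c   ≡⟨ cong (λ z → z * 2 ^ (k ∸ j) + rev (k ∸ j) c) (rev-zero j) ⟩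
  rev (k ∸ j) c                           ∎
  where open ≡-Reasoning

rev-aligned-< : ∀ {j k T} → j ≤ k → 2 ^ j ∣ T → rev k T < 2 ^ (k ∸ j)
rev-aligned-< {j} {k} j≤k (divides c refl) =
  subst (_< 2 ^ (k ∸ j)) (sym (trans (cong (rev k) (*-comm c (2 ^ j))) (rev-aligned c j≤k))) (rev-< (k ∸ j) c)

rev-offset : ∀ {j k T m} → j ≤ k → 2 ^ j ∣ T → m < 2 ^ j → rev k (T + m) ≡ rev j m * 2 ^ (k ∸ j) + rev k T
rev-offset {j} {k} {m = m} j≤k (divides c refl) m< = begin
  rev k (c * 2 ^ j + m)                   ≡⟨ cong (λ z → rev k (z + m)) (*-comm c (2 ^ j)) ⟩
  rev k (2 ^ j * c + m)                   ≡⟨ rev-split-≤ c j≤k m< ⟩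
  rev j m * 2 ^ (k ∸ j) + rev (k ∸ j) c   ≡⟨ cong (λ v → rev j m * 2 ^ (k ∸ j) + v) (rev-aligned c j≤k) ⟨
  rev j m * 2 ^ (k ∸ j) + rev k (2 ^ j * c) ≡⟨ cong (λ z → rev j m * 2 ^ (k ∸ j) + rev k z) (*-comm (2 ^ j) c) ⟩
  rev j m * 2 ^ (k ∸ j) + rev k (c * 2 ^ j) ∎
  where open ≡-Reasoning

EarlierRevsCover : ℕ → ℕ → Set
EarlierRevsCover j m = ∀ q → rev j m < q → q < 2 ^ j → ∃[ m₀ ] m₀ < m × rev j m < rev j m₀ × rev j m₀ ≤ q

upper-half-cover : ∀ j {m} → 2 ^ j ≤ m → m < 2 ^ suc j → EarlierRevsCover (suc j) m
upper-half-cover j {m} 2^j≤m m< q rev-m<q q< = m₀ , <-≤-trans (rev-< j h) 2^j≤m , rev-m<rev-m₀ , rev-m₀≤q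
  where
  h = q / 2
  m₀ = rev j h
  m′ = m ∸ 2 ^ j
  g = rev j m′
  m′< : m′ < 2 ^ j
  m′< = m<n+o⇒m∸n<o m (2 ^ j) {{m^n≢0 2 j}} (subst (m <_) (cong (λ v → 2 ^ j + v) (+-identityʳ (2 ^ j))) m<)
  rev-m : rev (suc j) m ≡ 1 + g * 2
  rev-m = begin
    rev (suc j) m                ≡⟨ cong (rev (suc j)) (m+[n∸m]≡n 2^j≤m) ⟨
    rev (suc j) (2 ^ j + m′)     ≡⟨ cong (λ z → rev (suc j) (z + m′)) (*-identityʳ (2 ^ j)) ⟨
    rev (suc j) (2 ^ j * 1 + m′) ≡⟨ rev-top j (s≤s (s≤s z≤n)) m′< ⟩
    1 + g * 2                    ∎
    where open ≡-Reasoning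
  rev-m₀ : rev (suc j) m₀ ≡ h * 2
  rev-m₀ = begin
    rev (suc j) m₀                ≡⟨ cong (λ z → rev (suc j) (z + m₀)) (*-zeroʳ (2 ^ j)) ⟨
    rev (suc j) (2 ^ j * 0 + m₀)  ≡⟨ rev-top j (s≤s z≤n) (rev-< j h) ⟩
    rev j m₀ * 2                  ≡⟨ cong (_* 2) (rev-involutive j (half-< j q q<)) ⟩
    h * 2                         ∎
    where open ≡-Reasoning
  rev-m₀≤q : rev (suc j) m₀ ≤ q
  rev-m₀≤q = subst (_≤ q) (sym rev-m₀) (m/n*n≤m q 2)
  g<h : g < h
  g<h = *-cancelʳ-< 2 g h (s≤s⁻¹ (begin-strict
    suc (g * 2)         ≡⟨ rev-m ⟨
    rev (suc j) m       <⟨ rev-m<q ⟩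
    q                   ≡⟨ m≡m%n+[m/n]*n q 2 ⟩
    q % 2 + h * 2       ≤⟨ +-monoˡ-≤ (h * 2) (s≤s⁻¹ (m%n<n q 2)) ⟩
    suc (h * 2)         ∎))
    where open ≤-Reasoning
  rev-m<rev-m₀ : rev (suc j) m < rev (suc j) m₀
  rev-m<rev-m₀ = subst₂ _<_ (sym rev-m) (sym rev-m₀) (*-monoˡ-≤ 2 g<h)

earlier-offset-between : ∀ {j k T m Y} → j ≤ k → 2 ^ j ∣ T → m < 2 ^ j → EarlierRevsCover j m →
  _%_ Y (2 ^ (k ∸ j)) {{m^n≢0 2 (k ∸ j)}} ≡ rev k T → rev k (T + m) < Y → Y < 2 ^ k →
  ∃[ m₀ ] m₀ < m × rev k (T + m) < rev k (T + m₀) × rev k (T + m₀) ≤ Y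
earlier-offset-between {j} {k} {T} {m} {Y} j≤k 2^j∣T m< cover Y%M≡R rev-t<Y Y<2^k = lift (cover q rev-m<q q<)
  where
  M = 2 ^ (k ∸ j)
  instance
    M≢0 : NonZero M
    M≢0 = m^n≢0 2 (k ∸ j)
  R = rev k T
  q = Y / M
  Y≡ : Y ≡ q * M + R
  Y≡ = trans (m≡m%n+[m/n]*n Y M) (trans (cong (_+ q * M) Y%M≡R) (+-comm R (q * M)))
  expand : ∀ {m′} → m′ < 2 ^ j → rev k (T + m′) ≡ rev j m′ * M + R
  expand = rev-offset j≤k 2^j∣T
  rev-m<q : rev j m < q
  rev-m<q = *-cancelʳ-< M (rev j m) q (+-cancelʳ-< R (rev j m * M) (q * M)
              (subst₂ _<_ (expand m<) Y≡ rev-t<Y))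
  q< : q < 2 ^ j
  q< = m<n*o⇒m/o<n (subst (Y <_) (trans (cong (2 ^_) (sym (m+[n∸m]≡n j≤k))) (^-distribˡ-+-* 2 j (k ∸ j))) Y<2^k)
  lift : ∃[ m₀ ] m₀ < m × rev j m < rev j m₀ × rev j m₀ ≤ q →
         ∃[ m₀ ] m₀ < m × rev k (T + m) < rev k (T + m₀) × rev k (T + m₀) ≤ Y
  lift (m₀ , m₀<m , ρ<ρ₀ , ρ₀≤q) =
    m₀ , m₀<m ,
    subst₂ _<_ (sym (expand m<)) (sym (expand m₀<)) (+-monoˡ-< R (*-monoˡ-< M ρ<ρ₀)) ,
    subst₂ _≤_ (sym (expand m₀<)) (sym Y≡) (+-monoˡ-≤ R (*-monoˡ-≤ M ρ₀≤q))
    where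
    m₀< : m₀ < 2 ^ j
    m₀< = <-trans m₀<m m<

if-does : ∀ {p a b} {P : Set p} {A : Set a} (B : A → Set b) {x y : A} (d : Dec P) →
          (P → B x) → (¬ P → B y) → B (if does d then x else y)
if-does B (yes p) f g = f p
if-does B (no ¬p) f g = g ¬p

maxPow2-≤ : ∀ l t → maxPow2 l t ≤ l
maxPow2-≤ zero t = z≤n
maxPow2-≤ (suc l) t = if-does (_≤ suc l) (2 ^ suc l ∣? t) (λ _ → ≤-refl) (λ _ → m≤n⇒m≤1+n (maxPow2-≤ l t))

2^maxPow2-∣ : ∀ l t → 2 ^ maxPow2 l t ∣ t
2^maxPow2-∣ zero t = 1∣ t
2^maxPow2-∣ (suc l) t = if-does (λ e → 2 ^ e ∣ t) (2 ^ suc l ∣? t) (λ 2^l∣t → 2^l∣t) (λ _ → 2^maxPow2-∣ l t)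

module Receiver (k : ℕ) (κ : ℕ → ℚ) (κ' κ'' : ℚ) (s : ℕ) where
  open RBO k κ κ' κ'' s

  search-≤ : ∀ i f → search i f ≤ i + f
  search-≤ i zero = m≤m+n i 0
  search-≤ i (suc f) = if-does (_≤ i + suc f) (κ' ℚ.≤? κ i) (λ _ → m≤m+n i (suc f))
    (λ _ → subst (search (suc i) f ≤_) (sym (+-suc i f)) (search-≤ (suc i) f))

  search-below : ∀ i f {r} → i ≤ r → r < search i f → κ r ℚ.< κ'
  search-below i zero i≤r r<i = contradiction i≤r (<⇒≱ r<i)
  search-below i (suc f) {r} i≤r = if-does (λ v → r < v → κ r ℚ.< κ') (κ' ℚ.≤? κ i)
    (λ _ r<i → contradiction i≤r (<⇒≱ r<i))
    (λ κ'≰κᵢ r< → [ (λ i<r → search-below (suc i) f i<r r<) , (λ { refl → ℚ.≰⇒> κ'≰κᵢ }) ]′ (m≤n⇒m<n∨m≡n i≤r))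

  search-hit : ∀ i f → search i f < i + f → κ' ℚ.≤ κ (search i f)
  search-hit i zero i<i+0 = contradiction (sym (+-identityʳ i)) (<⇒≢ i<i+0)
  search-hit i (suc f) = if-does (λ v → v < i + suc f → κ' ℚ.≤ κ v) (κ' ℚ.≤? κ i)
    (λ κ'≤κᵢ _ → κ'≤κᵢ) (λ _ lt → search-hit (suc i) f (subst (search (suc i) f <_) (+-suc i f) lt))

  r'≤n : r' ≤ n
  r'≤n = search-≤ 0 n

  <r'⇒κ<κ' : ∀ {r} → r < r' → κ r ℚ.< κ'
  <r'⇒κ<κ' = search-below 0 n z≤n

  step-lb : ∀ t lb ub → proj₁ (step t (lb , ub)) ≡ lb ⊎
            (lb ℤ.≤ ℤ.+ rev k t × κ (rev k t) ℚ.< κ' × proj₁ (step t (lb , ub)) ≡ ℤ.+ rev k t ℤ.+ ℤ.1ℤ)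
  step-lb t lb ub with lb ℤ.≤? ℤ.+ rev k t | ℤ.+ rev k t ℤ.≤? ub
  ... | yes lb≤r | yes _ = if-does (λ lb′ → lb′ ≡ lb ⊎ (lb ℤ.≤ ℤ.+ rev k t × κ (rev k t) ℚ.< κ' × lb′ ≡ ℤ.+ rev k t ℤ.+ ℤ.1ℤ))
                             (κ (rev k t) ℚ.<? κ') (λ κᵣ<κ' → inj₂ (lb≤r , κᵣ<κ' , refl)) (λ _ → inj₁ refl)
  ... | yes _ | no _ = inj₁ refl
  ... | no _ | _ = inj₁ refl

  step-lb-forced : ∀ t lb ub → ℤ.+ rev k t ℤ.≤ ub → κ (rev k t) ℚ.< κ' → ℤ.+ rev k t ℤ.< proj₁ (step t (lb , ub))
  step-lb-forced t lb ub r≤ub κᵣ<κ' with lb ℤ.≤? ℤ.+ rev k t | ℤ.+ rev k t ℤ.≤? ub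
  ... | yes _ | yes _ = if-does (ℤ.+ rev k t ℤ.<_) (κ (rev k t) ℚ.<? κ')
                          (λ _ → ℤ.+<+ (subst (rev k t <_) (+-comm 1 (rev k t)) ≤-refl)) (contradiction κᵣ<κ')
  ... | yes _ | no r≰ub = contradiction r≤ub r≰ub
  ... | no lb≰r | _ = ℤ.≰⇒> lb≰r

  step-ub-above : ∀ t lb ub {y} → κ' ℚ.≤ κ'' → y < r' → ℤ.+ y ℤ.≤ ub → ℤ.+ y ℤ.≤ proj₂ (step t (lb , ub))
  step-ub-above t lb ub {y} κ'≤κ'' y<r' y≤ub with lb ℤ.≤? ℤ.+ rev k t | ℤ.+ rev k t ℤ.≤? ub
  ... | yes _ | yes _ = if-does (ℤ.+ y ℤ.≤_) (κ'' ℚ.<? κ (rev k t)) y≤r-1 (λ _ → y≤ub)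
    where
    y≤r-1 : κ'' ℚ.< κ (rev k t) → ℤ.+ y ℤ.≤ ℤ.+ rev k t ℤ.- ℤ.1ℤ
    y≤r-1 κ''<κᵣ = subst (ℤ.+ y ℤ.≤_) (ℤ.+-comm ℤ.-1ℤ (ℤ.+ rev k t)) (ℤ.i<j⇒i≤pred[j] (ℤ.+<+ y<r))
      where
      y<r : y < rev k t
      y<r = <-≤-trans y<r' (≮⇒≥ (λ r<r' → ℚ.<-asym (<r'⇒κ<κ' r<r') (ℚ.≤-<-trans κ'≤κ'' κ''<κᵣ)))
  ... | yes _ | no _ = y≤ub
  ... | no _ | _ = y≤ub

  step-lb-mono : ∀ t st → proj₁ st ℤ.≤ proj₁ (step t st)
  step-lb-mono t (lb , ub) with step-lb t lb ub
  ... | inj₁ unchanged = ℤ.≤-reflexive (sym unchanged)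
  ... | inj₂ (lb≤r , _ , jumped) = ℤ.≤-trans lb≤r (subst (ℤ.+ rev k t ℤ.≤_) (sym jumped) (ℤ.+≤+ (m≤m+n (rev k t) 1)))

  run-lb-mono : ∀ {m m′} → m ≤′ m′ → proj₁ (run m) ℤ.≤ proj₁ (run m′)
  run-lb-mono ≤′-refl = ℤ.≤-refl
  run-lb-mono (≤′-step m≤′m′) = ℤ.≤-trans (run-lb-mono m≤′m′) (step-lb-mono _ _)

  lbAt-mono : ∀ {u t} → u ≤ t → lbAt u ℤ.≤ lbAt t
  lbAt-mono u≤t = run-lb-mono (≤⇒≤′ (∸-monoˡ-≤ s u≤t))

  run-suc-∸ : ∀ {t} → s ≤ t → run (suc t ∸ s) ≡ step t (run (t ∸ s))
  run-suc-∸ {t} s≤t = trans (cong run (+-∸-assoc 1 s≤t)) (cong (λ u → step u (run (t ∸ s))) (m+[n∸m]≡n s≤t))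

  lbAt-jump : ∀ {t} → s ≤ t → lbAt (suc t) ≢ lbAt t →
              lbAt t ℤ.≤ ℤ.+ rev k t × κ (rev k t) ℚ.< κ' × lbAt (suc t) ≡ ℤ.+ rev k t ℤ.+ ℤ.1ℤ
  lbAt-jump {t} s≤t changed rewrite run-suc-∸ s≤t with step-lb t (lbAt t) (proj₂ (run (t ∸ s)))
  ... | inj₁ unchanged = contradiction unchanged changed
  ... | inj₂ jump = jump

  s≤tseq : ∀ i → s ≤ tseq i
  s≤tseq zero = ≤-refl
  s≤tseq (suc i) = ≤-trans (s≤tseq i) (m≤m+n (tseq i) _)

  lseq≤k : ∀ i → lseq i ≤ k
  lseq≤k i = maxPow2-≤ k (tseq i)

  2^j∣tseq : ∀ i {j} → j ≤ lseq i → 2 ^ j ∣ tseq i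
  2^j∣tseq i j≤l = ∣-trans (2^-∣ j≤l) (2^maxPow2-∣ k (tseq i))

  val-β : ∀ i e → val (replicate e false ++ β i) ≡ rev k (tseq i)
  val-β i e = begin
    val (replicate e false ++ β i)                           ≡⟨ val-++ (replicate e false) (β i) ⟩
    val (replicate e false) * 2 ^ length (β i) + val (β i)   ≡⟨ cong (λ z → z * 2 ^ length (β i) + val (β i)) (val-replicate-false e) ⟩
    val (β i)                                                ≡⟨ val-drop-bin (lseq≤k i) (rev-aligned-< (lseq≤k i) (2^maxPow2-∣ k (tseq i))) ⟩
    rev k (tseq i)                                           ∎
    where open ≡-Reasoning

  InY-offset : ∀ i j {t} → InY i j t → ∃[ m ] t ≡ tseq i + m × m < 2 ^ j × EarlierRevsCover j m
  InY-offset i zero t≡T = 0 , trans t≡T (sym (+-identityʳ (tseq i))) , s≤s z≤n , λ { zero () ; (suc _) _ (s≤s ()) }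
  InY-offset i (suc j) {t} (lo , hi) = m , sym (m+[n∸m]≡n T≤t) , m<P , upper-half-cover j 2^j≤m m<P
    where
    T = tseq i
    P = 2 ^ suc j
    m = t ∸ T
    T≤t : T ≤ t
    T≤t = ≤-trans (m≤m+n T (2 ^ j)) lo
    2^j≤m : 2 ^ j ≤ m
    2^j≤m = subst (_≤ m) (m+n∸m≡n T (2 ^ j)) (∸-monoˡ-≤ T lo)
    m≤P-1 : m ≤ P ∸ 1
    m≤P-1 = subst (m ≤_) (trans (cong (_∸ T) (+-∸-assoc T (m^n>0 2 (suc j)))) (m+n∸m≡n T (P ∸ 1))) (∸-monoˡ-≤ T hi)
    m<P : m < P
    m<P = m≤pred[n]⇒suc[m]≤n {{m^n≢0 2 (suc j)}} m≤P-1

  module _ (κ-mono : ∀ a b → a ≤ b → b < n → κ a ℚ.≤ κ b) (κ'≤κ'' : κ' ℚ.≤ κ'') where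

    κ<κ'⇒<r' : ∀ {r} → r < n → κ r ℚ.< κ' → r < r'
    κ<κ'⇒<r' {r} r<n κᵣ<κ' = ≰⇒> r'≰r
      where
      r'≰r : ¬ r' ≤ r
      r'≰r r'≤r = ℚ.<-irrefl refl (ℚ.<-≤-trans κᵣ<κ'
                    (ℚ.≤-trans (search-hit 0 n (≤-<-trans r'≤r r<n)) (κ-mono r' r r'≤r r<n)))

    run-ub-above : ∀ m {y} → y < r' → ℤ.+ y ℤ.≤ proj₂ (run m)
    run-ub-above zero y<r' = ℤ.+≤+ (∸-monoˡ-≤ 1 (<-≤-trans y<r' r'≤n))
    run-ub-above (suc m) y<r' = step-ub-above (s + m) (proj₁ (run m)) (proj₂ (run m)) κ'≤κ'' y<r' (run-ub-above m y<r')

    lbAt-forced : ∀ {u} → s ≤ u → rev k u < r' → ℤ.+ rev k u ℤ.< lbAt (suc u)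
    lbAt-forced {u} s≤u r<r' rewrite run-suc-∸ s≤u =
      step-lb-forced u (lbAt u) (proj₂ (run (u ∸ s))) (run-ub-above (u ∸ s) r<r') (<r'⇒κ<κ' r<r')

    no-earlier-slot-between : ∀ {u t} → s ≤ u → u < t → lbAt (suc t) ≢ lbAt t →
                              rev k t < rev k u → rev k u < r' → ⊥
    no-earlier-slot-between {u} {t} s≤u u<t changed rₜ<rᵤ rᵤ<r' = ℤ.<-irrefl refl (begin-strict
      lbAt t          ≤⟨ proj₁ (lbAt-jump (≤-trans s≤u (<⇒≤ u<t)) changed) ⟩
      ℤ.+ rev k t     <⟨ ℤ.+<+ rₜ<rᵤ ⟩
      ℤ.+ rev k u     <⟨ lbAt-forced s≤u rᵤ<r' ⟩
      lbAt (suc u)    ≤⟨ lbAt-mono u<t ⟩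
      lbAt t          ∎)
      where open ℤ.≤-Reasoning

    InL-jump : ∀ {t x} → s ≤ t → InL t x → x ≡ ℤ.+ rev k t × rev k t < r' × lbAt (suc t) ≢ lbAt t
    InL-jump {t} {x} s≤t (x≡ , x≢) = x≡r , κ<κ'⇒<r' (rev-< k t) κᵣ<κ' , changed
      where
      changed : lbAt (suc t) ≢ lbAt t
      changed eq = x≢ (trans x≡ (cong (ℤ._- ℤ.1ℤ) eq))
      jump = lbAt-jump s≤t changed
      κᵣ<κ' = proj₁ (proj₂ jump)
      x≡r : x ≡ ℤ.+ rev k t
      x≡r = begin
        x                                   ≡⟨ x≡ ⟩
        lbAt (suc t) ℤ.- ℤ.1ℤ               ≡⟨ cong (ℤ._- ℤ.1ℤ) (proj₂ (proj₂ jump)) ⟩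
        ℤ.+ rev k t ℤ.+ ℤ.1ℤ ℤ.- ℤ.1ℤ       ≡⟨ ℤ.+-assoc (ℤ.+ rev k t) ℤ.1ℤ ℤ.-1ℤ ⟩
        ℤ.+ rev k t ℤ.+ ℤ.0ℤ                ≡⟨ ℤ.+-identityʳ (ℤ.+ rev k t) ⟩
        ℤ.+ rev k t                         ∎
        where open ≡-Reasoning

    jump-rev-maximal : ∀ {i j m Y} → j ≤ lseq i → m < 2 ^ j → EarlierRevsCover j m →
      lbAt (suc (tseq i + m)) ≢ lbAt (tseq i + m) → InXX i j (ℤ.+ Y) → Y < r' → Y ≤ rev k (tseq i + m)
    jump-rev-maximal {i} {j} {m} {Y} j≤l m< cover changed Y∈𝕏 Y<r' with Y ≤? rev k (tseq i + m)
    ... | yes Y≤ = Y≤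
    ... | no Y≰ with earlier-offset-between (≤-trans j≤l (lseq≤k i)) (2^j∣tseq i j≤l) m< cover
                       (trans Y∈𝕏 (val-β i (lseq i ∸ j))) (≰⇒> Y≰) (<-≤-trans Y<r' r'≤n)
    ...   | m₀ , m₀<m , rₜ<rᵤ , rᵤ≤Y = ⊥-elim (no-earlier-slot-between (≤-trans (s≤tseq i) (m≤m+n (tseq i) m₀))
                                         (+-monoʳ-< (tseq i) m₀<m) changed rₜ<rᵤ (≤-<-trans rᵤ≤Y Y<r'))

    L⊆p′∩X : ∀ i j → j ≤ lseq i → ∀ {t x} → InY i j t → InL t x → IsP' i j x × InX i j x
    L⊆p′∩X i j j≤l {t} {x} t∈Y x∈L with InY-offset i j t∈Y
    ... | m , refl , m< , cover with InL-jump (≤-trans (s≤tseq i) (m≤m+n (tseq i) m)) x∈L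
    ...   | refl , rₜ<r' , changed = ((x∈𝕏 , ℤ.+<+ rₜ<r') , maximal) , (tseq i + m , t∈Y , refl)
      where
      M = 2 ^ (k ∸ j)
      instance
        M≢0 : NonZero M
        M≢0 = m^n≢0 2 (k ∸ j)
      j≤k = ≤-trans j≤l (lseq≤k i)
      R = rev k (tseq i)
      x∈𝕏 : InXX i j x
      x∈𝕏 = begin
        rev k (tseq i + m) % M           ≡⟨ cong (_% M) (trans (rev-offset j≤k (2^j∣tseq i j≤l) m<) (+-comm (rev j m * M) R)) ⟩
        (R + rev j m * M) % M            ≡⟨ [m+kn]%n≡m%n R (rev j m) M ⟩
        R % M                            ≡⟨ m<n⇒m%n≡m (rev-aligned-< j≤k (2^j∣tseq i j≤l)) ⟩
        R                                ≡⟨ val-β i (lseq i ∸ j) ⟨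
        val (replicate (lseq i ∸ j) false ++ β i) ∎
        where open ≡-Reasoning
      maximal : ∀ y → InXX i j y × y ℤ.< ℤ.+ r' → y ℤ.≤ x
      maximal ℤ.-[1+ _ ] _ = ℤ.-≤+
      maximal (ℤ.+ Y) (Y∈𝕏 , ℤ.+<+ Y<r') = ℤ.+≤+ (jump-rev-maximal {i} j≤l m< cover changed Y∈𝕏 Y<r')

lemma3 : (k : ℕ) → 2 ≤ k →
    (κ : ℕ → ℚ) → (∀ a b → a ≤ b → b < 2 ^ k → κ a ≤ℚ κ b) →
    (κ' κ'' : ℚ) → κ' ≤ℚ κ'' →
    (s : ℕ) → s < 2 ^ k →
    (+ 0 <ℤ RBO.lbAt k κ κ' κ'' s (suc s)) →
    (∀ t → s ≤ t → t ≤ s + 2 ^ k ∸ 1 →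
      + 0 <ℤ RBO.lbAt k κ κ' κ'' s (suc t) → s ≤ t) →
    (i : ℕ) → (∀ i₀ → i₀ < i → RBO.lseq k κ κ' κ'' s i₀ ≢ k) →
    (j : ℕ) → j ≤ RBO.lseq k κ κ' κ'' s i →
    (t : ℕ) → RBO.InY k κ κ' κ'' s i j t →
    (x : ℤ) → RBO.InL k κ κ' κ'' s t x →
    RBO.IsP' k κ κ' κ'' s i j x × RBO.InX k κ κ' κ'' s i j x
lemma3 k _ κ κ-mono κ' κ'' κ'≤κ'' s _ _ _ i _ j j≤l t t∈Y x x∈L =
  Receiver.L⊆p′∩X k κ κ' κ'' s κ-mono κ'≤κ'' i j j≤l t∈Y x∈L
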